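{- Each of the following classes of frames $\langle W,R\rangle$ is definable in $\mathbf{K}^\blacktriangle_\mathbf{FDE}$: (i) $\mathbf{T}$, the frames with $R$ reflexive; (ii) $\mathbf{S4}$, the frames with $R$ reflexive and transitive; (iii) $\mathbf{S5}$, the frames with $R$ an equivalence relation; (iv) $\mathbf{F}$, the partial-functional frames, i.e., for all $x,y,z$, if $R(x,y)$ and $R(x,z)$ then $y=z$; (v) $\mathbf{Ver}$, the frames with $R=\varnothing$; (vi) $\mathbf{1}$, the coreflexive frames, i.e., for all $x,y$, if $R(x,y)$ then $x=y$.
   Context: Formulas of $\mathcal{L}_\blacktriangle$: $\phi::=p\mid\neg\phi\mid\phi\wedge\phi\mid\phi\vee\phi\mid\blacktriangle\phi$, $p$ in a countable set $\mathsf{Var}$. A frame is $\langle W,R\rangle$, $W\neq\varnothing$, $R\subseteq W^2$; a model on it is $\langle W,R,v^+,v^-\rangle$ with independent $v^+,v^-:\mathsf{Var}\to 2^W$. $w\vDash^+p$ iff $w\in v^+(p)$; $w\vDash^-p$ iff $w\in v^-(p)$; $\neg$ swaps $\vDash^+$ and $\vDash^-$; $\wedge$: true iff both true, false iff some false; $\vee$: true iff some true, false iff both false. $w_0\vDash^+\blacktriangle\phi$ iff for all $R$-successors $w_1,w_2$ of $w_0$, ($w_1\vDash^+\phi\Rightarrow w_2\vDash^+\phi$) and ($w_1\vDash^-\phi\Rightarrow w_2\vDash^-\phi$), and every $R$-successor $w_1$ has $w_1\vDash^+\phi$ or $w_1\vDash^-\phi$. $w_0\vDash^-\blacktriangle\phi$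 iff there are successors $w_1,w_2$ of $w_0$ with ($w_1\vDash^+\phi$, $w_2\nvDash^+\phi$) or ($w_1\vDash^-\phi$, $w_2\nvDash^-\phi$) or ($w_1\vDash^+\phi$, $w_2\vDash^-\phi$). A sequent $\phi\vdash\chi$ (with $\phi,\chi\in\mathcal{L}_\blacktriangle$) is valid on a frame $\mathfrak{F}$ iff for every model $\mathfrak{M}$ on $\mathfrak{F}$ and every state $w$, $\mathfrak{M},w\vDash^+\phi$ implies $\mathfrak{M},w\vDash^+\chi$. A set $\Sigma$ of such sequents defines a class $\mathbb{F}$ of frames iff for every frame $\mathfrak{F}$: $\mathfrak{F}\in\mathbb{F}$ iff every sequent in $\Sigma$ is valid on $\mathfrak{F}$. A class of frames is definable in $\mathbf{K}^\blacktriangle_\mathbf{FDE}$ iff some set of sequents defines it. -}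

module Defs where

open import Data.Nat using (ℕ)
open import Data.Product using (Σ; ∃; ∃-syntax; _×_; _,_)
open import Data.Sum using (_⊎_)
open import Relation.Nullary using (¬_)
open import Relation.Binary.PropositionalEquality using (_≡_)

Var : Set
Var = ℕ

infix  6 ¬'_
infixr 5 _∧'_
infixr 4 _∨'_
data Formula : Set where
  var   : Var → Formula
  ¬'_   : Formula → Formula
  _∧'_  : Formula → Formula → Formula
  _∨'_  : Formula → Formula → Formula
  ▲     : Formula → Formula

-- A frame ⟨W, R⟩ with W nonempty (witnessed by an element)
record Frame : Set₁ where
  field
    W     : Set
    R     : W → W → Set
    point : W

record Model (F : Frame) : Set₁ where
  open Frame F
  field
    v⁺ : Var → W → Set
    v⁻ : Var → W → Set

module _ {F : Frame} (M : Model F) where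
  open Frame F
  open Model M

  mutual
    sat⁺ : W → Formula → Set
    sat⁺ w (var p)   = v⁺ p w
    sat⁺ w (¬' φ)    = sat⁻ w φ
    sat⁺ w (φ ∧' ψ)  = sat⁺ w φ × sat⁺ w ψ
    sat⁺ w (φ ∨' ψ)  = sat⁺ w φ ⊎ sat⁺ w ψ
    sat⁺ w (▲ φ)     =
      (∀ w₁ w₂ → R w w₁ → R w w₂ →
         (sat⁺ w₁ φ → sat⁺ w₂ φ) × (sat⁻ w₁ φ → sat⁻ w₂ φ))
      × (∀ w₁ → R w w₁ → sat⁺ w₁ φ ⊎ sat⁻ w₁ φ)

    sat⁻ : W → Formula → Set
    sat⁻ w (var p)   = v⁻ p w
    sat⁻ w (¬' φ)    = sat⁺ w φ
    sat⁻ w (φ ∧' ψ)  = sat⁻ w φ ⊎ sat⁻ w ψ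
    sat⁻ w (φ ∨' ψ)  = sat⁻ w φ × sat⁻ w ψ
    sat⁻ w (▲ φ)     =
      ∃[ w₁ ] ∃[ w₂ ] (R w w₁ × R w w₂ ×
        ((sat⁺ w₁ φ × ¬ sat⁺ w₂ φ)
         ⊎ (sat⁻ w₁ φ × ¬ sat⁻ w₂ φ)
         ⊎ (sat⁺ w₁ φ × sat⁻ w₂ φ)))

Sequent : Set
Sequent = Formula × Formula

Valid : Frame → Sequent → Set₁
Valid F (φ , χ) = (M : Model F) (w : Frame.W F) → sat⁺ M w φ → sat⁺ M w χ

FrameClass : Set₁
FrameClass = Frame → Set

Defines : (Sequent → Set) → FrameClass → Set₁
Defines Σs 𝔽 = (F : Frame) →
  (𝔽 F → (s : Sequent) → Σs s → Valid F s) ×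
  (((s : Sequent) → Σs s → Valid F s) → 𝔽 F)

Definable : FrameClass → Set₁
Definable 𝔽 = Σ (Sequent → Set) (λ Σs → Defines Σs 𝔽)

Reflexive : Frame → Set
Reflexive F = ∀ x → Frame.R F x x

Transitive : Frame → Set
Transitive F = ∀ x y z → Frame.R F x y → Frame.R F y z → Frame.R F x z

Symmetric : Frame → Set
Symmetric F = ∀ x y → Frame.R F x y → Frame.R F y x

T-frames : FrameClass
T-frames F = Reflexive F

S4-frames : FrameClass
S4-frames F = Reflexive F × Transitive F

S5-frames : FrameClass
S5-frames F = Reflexive F × Symmetric F × Transitive F

F-frames : FrameClass
F-frames F = ∀ x y z → Frame.R F x y → Frame.R F x z → y ≡ z

Ver-frames : FrameClass
Ver-frames F = ∀ x y → ¬ Frame.R F x y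

One-frames : FrameClass
One-frames F = ∀ x y → Frame.R F x y → x ≡ y

{-# OPTIONS --safe #-}
-- A state w refutes ▲φ as soon as φ is a glut at some successor of w, and ▲φ is itself a
-- glut at w exactly when w has a successor and φ is a glut at all of them. Hence a glut of
-- ▲q makes q false at every successor, and a refutation of ▲(ψ ∧ q) must then come from a
-- successor at which ψ is true; this is how the sequents for transitivity and symmetry
-- look two steps along R. In the converse direction, p is interpreted as glutted
-- exactly at a single state z, so that ¬▲p holds at x if and only if x R z.
module Submission where

open import Defs
open import Data.Empty using (⊥)
open import Data.Product using (_×_; _,_; proj₁; proj₂; ∃-syntax)
open import Data.Sum using (_⊎_; inj₁; inj₂; reduce)
open import Data.Unit using (⊤; tt)
open import Function using (id)
open import Relation.Nullary using (¬_; contradiction)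
open import Relation.Binary.PropositionalEquality using (_≡_; refl; sym; subst)

module _ {F : Frame} (M : Model F) where
  open Frame F

  Valued : W → Formula → Set
  Valued w φ = sat⁺ M w φ ⊎ sat⁻ M w φ

  Glut : W → Formula → Set
  Glut w φ = sat⁺ M w φ × sat⁻ M w φ

  ▲-false⇒valued-successor : ∀ {w} φ → sat⁻ M w (▲ φ) → ∃[ u ] R w u × Valued u φ
  ▲-false⇒valued-successor _ (u , _ , wRu , _ , inj₁ (u⊨φ , _))        = u , wRu , inj₁ u⊨φ
  ▲-false⇒valued-successor _ (u , _ , wRu , _ , inj₂ (inj₁ (u⫤φ , _))) = u , wRu , inj₂ u⫤φ
  ▲-false⇒valued-successor _ (u , _ , wRu , _ , inj₂ (inj₂ (u⊨φ , _))) = u , wRu , inj₁ u⊨φ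

  ▲-false⇒R : ∀ {x z} φ → (∀ {u} → Valued u φ → u ≡ z) → sat⁻ M x (▲ φ) → R x z
  ▲-false⇒R {x} φ valued-only-at-z refuted =
    let u , xRu , u-valued = ▲-false⇒valued-successor φ refuted
    in subst (R x) (valued-only-at-z u-valued) xRu

  ▲-false⇒true-successor : ∀ {w} φ → sat⁻ M w (▲ φ) → (∀ u → R w u → sat⁻ M u φ) →
                           ∃[ u ] R w u × sat⁺ M u φ
  ▲-false⇒true-successor _ (u , _ , wRu , _ , inj₁ (u⊨φ , _))        _     = u , wRu , u⊨φ
  ▲-false⇒true-successor _ (_ , v , _ , wRv , inj₂ (inj₁ (_ , v⫤̸φ))) false =
    contradiction (false v wRv) v⫤̸φ
  ▲-false⇒true-successor _ (u , _ , wRu , _ , inj₂ (inj₂ (u⊨φ , _))) _     = u , wRu , u⊨φ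

  glut-successor⇒▲-false : ∀ {w u} φ → R w u → Glut u φ → sat⁻ M w (▲ φ)
  glut-successor⇒▲-false _ wRu (u⊨φ , u⫤φ) = _ , _ , wRu , wRu , inj₂ (inj₂ (u⊨φ , u⫤φ))

  glut-successors⇒▲-glut : ∀ {w u} φ → R w u → (∀ v → R w v → Glut v φ) → Glut w (▲ φ)
  glut-successors⇒▲-glut φ wRu glut =
    ((λ _ v _ wRv → (λ _ → proj₁ (glut v wRv)) , (λ _ → proj₂ (glut v wRv))) ,
     (λ v wRv → inj₁ (proj₁ (glut v wRv)))) ,
    glut-successor⇒▲-false φ wRu (glut _ wRu)

  ▲-glut⇒glut-successors : ∀ {w} φ → Glut w (▲ φ) → ∀ u → R w u → Glut u φ
  ▲-glut⇒glut-successors _ ((agree , _) , _ , _ , wRs , wRt , inj₁ (s⊨φ , t⊭φ)) _ _ =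
    contradiction (proj₁ (agree _ _ wRs wRt) s⊨φ) t⊭φ
  ▲-glut⇒glut-successors _ ((agree , _) , _ , _ , wRs , wRt , inj₂ (inj₁ (s⫤φ , t⫤̸φ))) _ _ =
    contradiction (proj₂ (agree _ _ wRs wRt) s⫤φ) t⫤̸φ
  ▲-glut⇒glut-successors _ ((agree , _) , _ , _ , wRs , wRt , inj₂ (inj₂ (s⊨φ , t⫤φ))) u wRu =
    proj₁ (agree _ u wRs wRu) s⊨φ , proj₂ (agree _ u wRt wRu) t⫤φ

  ▲-false-mono : ∀ {w v} φ → (∀ u → R v u → R w u) → sat⁻ M v (▲ φ) → sat⁻ M w (▲ φ)
  ▲-false-mono _ v⊆w (s , t , vRs , vRt , disagree) = s , t , v⊆w s vRs , v⊆w t vRt , disagree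

  functional⇒▲-false⇒▲-true : F-frames F → ∀ {w} φ → sat⁻ M w (▲ φ) → sat⁺ M w (▲ φ)
  functional⇒▲-false⇒▲-true functional {w} φ refuted =
    let u , wRu , u-valued = ▲-false⇒valued-successor φ refuted
    in agree , λ v wRv → subst (λ x → Valued x φ) (functional w u v wRu wRv) u-valued
    where
    agree : ∀ s t → R w s → R w t → (sat⁺ M s φ → sat⁺ M t φ) × (sat⁻ M s φ → sat⁻ M t φ)
    agree s t wRs wRt with refl ← functional w s t wRs wRt = id , id

  coreflexive⇒valued⇒▲-true : One-frames F → ∀ {w} φ → Valued w φ → sat⁺ M w (▲ φ)
  coreflexive⇒valued⇒▲-true coreflexive {w} φ w-valued =
    agree , λ u wRu → subst (λ x → Valued x φ) (coreflexive w u wRu) w-valued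
    where
    agree : ∀ s t → R w s → R w t → (sat⁺ M s φ → sat⁺ M t φ) × (sat⁻ M s φ → sat⁻ M t φ)
    agree s t wRs wRt with refl ← coreflexive w s wRs | refl ← coreflexive w t wRt = id , id

  dead-end⇒▲-true : ∀ {w} φ → (∀ u → ¬ R w u) → sat⁺ M w (▲ φ)
  dead-end⇒▲-true _ dead =
    (λ _ v _ wRv → contradiction wRv (dead v)) , (λ u wRu → contradiction wRu (dead u))

_∩_ : FrameClass → FrameClass → FrameClass
(𝔽 ∩ 𝔾) F = 𝔽 F × 𝔾 F

∩-definable : ∀ {𝔽 𝔾} → Definable 𝔽 → Definable 𝔾 → Definable (𝔽 ∩ 𝔾)
∩-definable (Σ₁ , defines₁) (Σ₂ , defines₂) = (λ s → Σ₁ s ⊎ Σ₂ s) , λ F →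
  (λ { (𝔽F , _) s (inj₁ s∈Σ₁) → proj₁ (defines₁ F) 𝔽F s s∈Σ₁
     ; (_ , 𝔾F) s (inj₂ s∈Σ₂) → proj₁ (defines₂ F) 𝔾F s s∈Σ₂ }) ,
  (λ valid → proj₂ (defines₁ F) (λ s s∈Σ₁ → valid s (inj₁ s∈Σ₁)) ,
             proj₂ (defines₂ F) (λ s s∈Σ₂ → valid s (inj₂ s∈Σ₂)))

sequent-definable : ∀ {𝔽} (s : Sequent) →
                    (∀ {F} → 𝔽 F → Valid F s) → (∀ {F} → Valid F s → 𝔽 F) → Definable 𝔽
sequent-definable s sound complete =
  (_≡ s) , λ F → (λ { 𝔽F _ refl → sound 𝔽F }) , (λ valid → complete (valid s refl))

p q r : Formula
p = var 0
q = var 1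
r = var 2

glut : Formula → Formula
glut φ = φ ∧' ¬' φ

reflexivity-sequent transitivity-sequent symmetry-sequent : Sequent
reflexivity-sequent  = glut p , ¬' ▲ p
transitivity-sequent = glut (▲ q) ∧' ¬' ▲ (¬' ▲ p ∧' q) , ¬' ▲ p
symmetry-sequent     = glut p ∧' glut (▲ q) ∧' ¬' ▲ (r ∧' q) , ¬' ▲ (¬' ▲ p ∧' (r ∧' q))

functionality-sequent dead-end-sequent coreflexivity-sequent : Sequent
functionality-sequent = ¬' ▲ p , ▲ p
dead-end-sequent      = q , ▲ p
coreflexivity-sequent = p , ▲ p

module _ {F : Frame} where
  open Frame F

  -- Both valuations agree, so each variable is a glut on its extension and a gap elsewhere.
  model : (P Q S : W → Set) → Model F
  model P Q S = record { v⁺ = extension ; v⁻ = extension }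
    where
    extension : Var → W → Set
    extension 0 = P
    extension 1 = Q
    extension 2 = S
    extension _ = λ _ → ⊥

  reflexive⇒valid : Reflexive F → Valid F reflexivity-sequent
  reflexive⇒valid reflexive M w p-glut = glut-successor⇒▲-false M p (reflexive w) p-glut

  valid⇒reflexive : Valid F reflexivity-sequent → Reflexive F
  valid⇒reflexive valid x = ▲-false⇒R M p reduce (valid M x (refl , refl))
    where
    M : Model F
    M = model (_≡ x) (λ _ → ⊤) (λ _ → ⊤)

  transitive⇒valid : Transitive F → Valid F transitivity-sequent
  transitive⇒valid transitive M w (▲q-glut , refuted) =
    let v , wRv , (▲p-false , _) = ▲-false⇒true-successor M (¬' ▲ p ∧' q) refuted
                                     (λ u wRu → inj₂ (q-false u wRu))
    in ▲-false-mono M p (λ u → transitive w v u wRv) ▲p-false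
    where
    q-false : ∀ u → R w u → sat⁻ M u q
    q-false u wRu = proj₂ (▲-glut⇒glut-successors M q ▲q-glut u wRu)

  valid⇒transitive : Valid F transitivity-sequent → Transitive F
  valid⇒transitive valid x y z xRy yRz =
    ▲-false⇒R M p reduce
      (valid M x (▲q-glut , glut-successor⇒▲-false M (¬' ▲ p ∧' q) xRy ¬▲p∧q-glut-at-y))
    where
    M : Model F
    M = model (_≡ z) (λ _ → ⊤) (λ _ → ⊤)
    ▲q-glut : Glut M x (▲ q)
    ▲q-glut = glut-successors⇒▲-glut M q xRy (λ _ _ → tt , tt)
    ¬▲p∧q-glut-at-y : Glut M y (¬' ▲ p ∧' q)
    ¬▲p∧q-glut-at-y = (glut-successor⇒▲-false M p yRz (refl , refl) , tt) , inj₂ tt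

  symmetric⇒valid : Symmetric F → Valid F symmetry-sequent
  symmetric⇒valid symmetric M w (p-glut , ▲q-glut , refuted) =
    let v , wRv , r∧q-true = ▲-false⇒true-successor M (r ∧' q) refuted
                               (λ u wRu → inj₂ (q-false u wRu))
        ▲p-false-at-v      = glut-successor⇒▲-false M p (symmetric w v wRv) p-glut
    in glut-successor⇒▲-false M (¬' ▲ p ∧' (r ∧' q)) wRv
         ((▲p-false-at-v , r∧q-true) , inj₂ (inj₂ (q-false v wRv)))
    where
    q-false : ∀ u → R w u → sat⁻ M u q
    q-false u wRu = proj₂ (▲-glut⇒glut-successors M q ▲q-glut u wRu)

  valid⇒symmetric : Valid F symmetry-sequent → Symmetric F
  valid⇒symmetric valid x y xRy =
    let v , _ , (▲p-false , v≡y , _) = ▲-false⇒true-successor M (¬' ▲ p ∧' (r ∧' q)) refuted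
                                         (λ _ _ → inj₂ (inj₂ tt))
    in subst (λ v → R v x) v≡y (▲-false⇒R M p reduce ▲p-false)
    where
    M : Model F
    M = model (_≡ x) (λ _ → ⊤) (_≡ y)
    refuted : sat⁻ M x (▲ (¬' ▲ p ∧' (r ∧' q)))
    refuted = valid M x ((refl , refl) ,
                         glut-successors⇒▲-glut M q xRy (λ _ _ → tt , tt) ,
                         glut-successor⇒▲-false M (r ∧' q) xRy ((refl , tt) , inj₂ tt))

  functional⇒valid : F-frames F → Valid F functionality-sequent
  functional⇒valid functional M w = functional⇒▲-false⇒▲-true M functional p

  valid⇒functional : Valid F functionality-sequent → F-frames F
  valid⇒functional valid x y z xRy xRz = sym (proj₁ (proj₁ ▲p-true y z xRy xRz) refl)
    where
    M : Model F
    M = model (_≡ y) (λ _ → ⊤) (λ _ → ⊤)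
    ▲p-true : sat⁺ M x (▲ p)
    ▲p-true = valid M x (glut-successor⇒▲-false M p xRy (refl , refl))

  dead-end⇒valid : Ver-frames F → Valid F dead-end-sequent
  dead-end⇒valid dead M w _ = dead-end⇒▲-true M p (dead w)

  valid⇒dead-end : Valid F dead-end-sequent → Ver-frames F
  valid⇒dead-end valid x y xRy = reduce (proj₂ (valid M x tt) y xRy)
    where
    M : Model F
    M = model (λ _ → ⊥) (λ _ → ⊤) (λ _ → ⊤)

  coreflexive⇒valid : One-frames F → Valid F coreflexivity-sequent
  coreflexive⇒valid coreflexive M w w⊨p = coreflexive⇒valued⇒▲-true M coreflexive p (inj₁ w⊨p)

  valid⇒coreflexive : Valid F coreflexivity-sequent → One-frames F
  valid⇒coreflexive valid x y xRy = sym (reduce (proj₂ (valid M x refl) y xRy))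
    where
    M : Model F
    M = model (_≡ x) (λ _ → ⊤) (λ _ → ⊤)

theorem6 : Definable T-frames × Definable S4-frames × Definable S5-frames × Definable F-frames × Definable Ver-frames × Definable One-frames
theorem6 =
  reflexive-definable ,
  ∩-definable reflexive-definable transitive-definable ,
  ∩-definable reflexive-definable (∩-definable symmetric-definable transitive-definable) ,
  sequent-definable functionality-sequent functional⇒valid valid⇒functional ,
  sequent-definable dead-end-sequent dead-end⇒valid valid⇒dead-end ,
  sequent-definable coreflexivity-sequent coreflexive⇒valid valid⇒coreflexive
  where
  reflexive-definable : Definable Reflexive
  reflexive-definable = sequent-definable reflexivity-sequent reflexive⇒valid valid⇒reflexive
  transitive-definable : Definable Transitive
  transitive-definable = sequent-definable transitivity-sequent transitive⇒valid valid⇒transitive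
  symmetric-definable : Definable Symmetric
  symmetric-definable = sequent-definable symmetry-sequent symmetric⇒valid valid⇒symmetric
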